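{- Let $G$ be an MP-tree and suppose $e=(v,w)$ is a coloop of $M_G$. Then for every positive integer $k$, $\tau_G(k)=(k-1)\,\tau_{G/e}(k)$, where $G/e$ is the classical contraction of $e$.
   Context: Digraphs: finite, at most one edge $(v,w)$ from $v$ to $w$ for distinct $v,w$. A multipath is a spanning subgraph each of whose connected components is a vertex or a simple path (sequence of non-loop edges, target of each = source of next, no repeated vertex, not closing into a cycle); $M_G=(E(G),\mathrm{Mult}(G))$ with multipaths as edge sets. An MP-digraph satisfies (MP1) no subgraph isomorphic to $D_A$ (vertices $v_0,v_1,v_2$, edges $(v_1,v_0),(v_0,v_2),(v_1,v_2)$) or $D_B$ (vertices $v_0,\dots,v_3$, edges $(v_0,v_1),(v_2,v_1),(v_2,v_3)$) or their edge-reversals, and (MP2) every coherently oriented cycle of length $\ge2$ is a connected component; then $M_G$ is a matroid. An MP-tree is an MP-digraph whose underlying undirected graph is a tree. A coloop is an element of every basis. $G/e$ identifies $v$ and $w$ into one vertex and deletes $e$. A flowing $k$-colouring of a digraph $H$ is a map $c:V(H)\to\{1,\dots,k\}$ with $c(v)\ne c(w)$ for each edge $(v,w)$, $c(v)=c(v')$ whenever $(v,w),(v',w)$ are edges, and $c(v)=c(v')$ whenever $(w,v),(w,v')$ are edges; $\tau_H(k)$ is their number. -}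

module Defs where

open import Data.Nat using (ℕ; zero; suc; _≤_)
open import Data.Fin using (Fin; zero; suc; punchOut; _≟_)
open import Data.Bool using (Bool; true; false; _∧_; _∨_; not)
open import Data.List using (List; []; _∷_; _++_; [_]; concat; map; length; concatMap; filterᵇ; allFin)
open import Data.Bool.ListAction using (all; any)
open import Data.List.Membership.Propositional using (_∈_)
open import Data.List.Relation.Unary.Unique.Propositional using (Unique)
open import Data.List.Relation.Binary.Permutation.Propositional using (_↭_)
open import Data.Vec using (Vec; lookup) renaming ([] to []ᵥ; _∷_ to _∷ᵥ_)
open import Data.Product using (Σ; ∃; ∃₂; _×_; _,_)
open import Data.Sum using (_⊎_)
open import Data.Empty using (⊥)
open import Relation.Nullary using (¬_)
open import Relation.Nullary.Decidable using (⌊_⌋)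
open import Relation.Binary.PropositionalEquality using (_≡_; _≢_; sym)

-- Digraphs on the vertex set Fin n: G x y ≡ true iff (x , y) is an edge.
-- (At most one edge per ordered pair is built in.)

Digraph : ℕ → Set
Digraph n = Fin n → Fin n → Bool

Edge : ∀ {n} → Digraph n → Fin n → Fin n → Set
Edge G x y = G x y ≡ true

rev : ∀ {n} → Digraph n → Digraph n
rev G x y = G y x

SubgraphIso : ∀ {m n} → Digraph m → Digraph n → Set
SubgraphIso {m} {n} H G =
  Σ (Fin m → Fin n) λ f →
    (∀ i j → f i ≡ f j → i ≡ j) × (∀ i j → Edge H i j → Edge G (f i) (f j))

D-A : Digraph 3
D-A (suc zero) zero = true
D-A zero (suc (suc zero)) = true
D-A (suc zero) (suc (suc zero)) = true
D-A _ _ = false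

D-B : Digraph 4
D-B zero (suc zero) = true
D-B (suc (suc zero)) (suc zero) = true
D-B (suc (suc zero)) (suc (suc (suc zero))) = true
D-B _ _ = false

Consec : ∀ {n} → Fin n → Fin n → List (Fin n) → Set
Consec x y l = ∃₂ λ xs ys → l ≡ xs ++ x ∷ y ∷ ys

-- (x , y) is an edge of the closed walk u ∷ us → u
CycConsec : ∀ {n} → Fin n → Fin n → Fin n → List (Fin n) → Set
CycConsec x y u us =
  Consec x y (u ∷ us) ⊎ (∃ λ xs → (u ∷ us ≡ xs ++ [ x ]) × (y ≡ u))

IsCohCycle : ∀ {n} → Digraph n → Fin n → List (Fin n) → Set
IsCohCycle G u us =
  Unique (u ∷ us) × (1 ≤ length us) × (∀ x y → CycConsec x y u us → Edge G x y)

-- The cycle is a connected component: every edge of G touching a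
-- vertex of the cycle is an edge of the cycle.
IsComponentCycle : ∀ {n} → Digraph n → Fin n → List (Fin n) → Set
IsComponentCycle G u us =
  ∀ x y → Edge G x y → (x ∈ u ∷ us ⊎ y ∈ u ∷ us) → CycConsec x y u us

MP1 : ∀ {n} → Digraph n → Set
MP1 G = ¬ SubgraphIso D-A G × ¬ SubgraphIso (rev D-A) G
      × ¬ SubgraphIso D-B G × ¬ SubgraphIso (rev D-B) G

MP2 : ∀ {n} → Digraph n → Set
MP2 G = ∀ u us → IsCohCycle G u us → IsComponentCycle G u us

IsMPDigraph : ∀ {n} → Digraph n → Set
IsMPDigraph G = MP1 G × MP2 G

UAdj : ∀ {n} → Digraph n → Fin n → Fin n → Set
UAdj G x y = Edge G x y ⊎ Edge G y x

data Connected {n} (G : Digraph n) : Fin n → Fin n → Set where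
  here : ∀ {x} → Connected G x x
  step : ∀ {x y z} → UAdj G x y → Connected G y z → Connected G x z

IsTree : ∀ {n} → Digraph n → Set
IsTree G =
  (∀ x → G x x ≡ false)
  -- no pair of antiparallel edges (they would give a double undirected edge)
  × (∀ x y → Edge G x y → Edge G y x → ⊥)
  × (∀ x y → Connected G x y)
  × (∀ u us → Unique (u ∷ us) → 2 ≤ length us →
       (∀ x y → CycConsec x y u us → UAdj G x y) → ⊥)

IsMPTree : ∀ {n} → Digraph n → Set
IsMPTree G = IsMPDigraph G × IsTree G

EdgeSet : ℕ → Set
EdgeSet n = Fin n → Fin n → Bool

_⊆ₑ_ : ∀ {n} → EdgeSet n → EdgeSet n → Set
S ⊆ₑ T = ∀ x y → S x y ≡ true → T x y ≡ true

-- S ⊆ E(G) is (the edge set of) a multipath: the vertex set is partitioned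
-- into lists of vertices (each a vertex or a simple path) and the edges of S
-- are exactly the consecutive pairs of these lists.
IsMultipath : ∀ {n} → Digraph n → EdgeSet n → Set
IsMultipath {n} G S =
  S ⊆ₑ G ×
  Σ (List (List (Fin n))) λ L →
    (concat L ↭ allFin n) ×
    (∀ x y → (S x y ≡ true → ∃ λ l → l ∈ L × Consec x y l)
           × ((∃ λ l → l ∈ L × Consec x y l) → S x y ≡ true))

IsBasis : ∀ {n} → Digraph n → EdgeSet n → Set
IsBasis G B = IsMultipath G B × (∀ T → IsMultipath G T → B ⊆ₑ T → T ⊆ₑ B)

IsColoop : ∀ {n} → Digraph n → Fin n → Fin n → Set
IsColoop G v w = Edge G v w × (∀ B → IsBasis G B → B v w ≡ true)

-- Contraction G/e of e = (v , w): w is identified with v, vertices are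
-- renumbered into Fin m via punchOut, and e is deleted.

merge : ∀ {m} (v w : Fin (suc m)) → v ≢ w → Fin (suc m) → Fin m
merge v w v≢w u with u ≟ w
... | Relation.Nullary.yes _ = punchOut {i = w} {j = v} (λ eq → v≢w (sym eq))
... | Relation.Nullary.no u≢w = punchOut {i = w} {j = u} (λ eq → u≢w (sym eq))

contract : ∀ {m} → Digraph (suc m) → (v w : Fin (suc m)) → v ≢ w → Digraph m
contract {m} G v w v≢w a b =
  any (λ x → any (λ y →
        G x y ∧ not (⌊ x ≟ v ⌋ ∧ ⌊ y ≟ w ⌋)
              ∧ ⌊ merge v w v≢w x ≟ a ⌋ ∧ ⌊ merge v w v≢w y ≟ b ⌋)
      (allFin (suc m))) (allFin (suc m))

allVecs : ∀ n k → List (Vec (Fin k) n)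
allVecs zero k = [ []ᵥ ]
allVecs (suc n) k = concatMap (λ x → map (x ∷ᵥ_) (allVecs n k)) (allFin k)

_==_ : ∀ {k} → Fin k → Fin k → Bool
a == b = ⌊ a ≟ b ⌋

isFlowing : ∀ {n k} → Digraph n → Vec (Fin k) n → Bool
isFlowing {n} H c =
  all (λ x → all (λ y →
      (not (H x y) ∨ not (lookup c x == lookup c y))
      ∧ all (λ x' → not (H x y ∧ H x' y) ∨ (lookup c x == lookup c x')) vs
      ∧ all (λ y' → not (H x y ∧ H x y') ∨ (lookup c y == lookup c y')) vs) vs) vs
  where vs = allFin n

τ : ∀ {n} → Digraph n → ℕ → ℕ
τ {n} H k = length (filterᵇ isFlowing' (allVecs n k))
  where isFlowing' = isFlowing H

{-# OPTIONS --safe #-}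

-- A coloop e = (v , w) of the multipath matroid is the only edge leaving v and the
-- only edge entering w: a second such edge is a one-edge multipath, and a basis
-- extending it cannot also contain e, since in a multipath every vertex has at most
-- one predecessor and one successor.  Consequently the flowing colourings of G are
-- those of G - e with c v ≢ c w, and the flowing colourings of G - e with c v ≡ c w
-- are those of G / e.  As G is a tree, G - e falls apart into the component of w and
-- the rest; exchanging two colours on the component of w alone preserves flowing
-- colourings, and exchanging c v with any of the k - 1 other colours b matches the
-- colourings of G - e with c v ≡ c w, paired with b, bijectively to those with
-- c v ≢ c w.  Extending a multipath to
-- a basis and splitting off a connected component are classical steps; they are
-- carried out under double negation, which the decidable conclusion absorbs.

module Submission where

open import Defs
open import Level using (Level)
open import Data.Bool using (Bool; true; false; T; _∧_; _∨_; not; if_then_else_)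
open import Data.Bool.ListAction using (all; any)
open import Data.Bool.Properties using (T-∧; T-≡; T?)
open import Data.Empty using (⊥; ⊥-elim)
open import Data.Fin as Fin using (Fin; _≟_; punchIn)
open import Data.Fin.Permutation.Components using (transpose; transpose-inverse)
open import Data.Fin.Properties using (punchIn-punchOut; punchOut-punchIn; punchOut-cong; punchOut-injective; punchInᵢ≢i)
open import Data.List using (List; []; _∷_; [_]; _++_; concat; map; concatMap; length; filterᵇ; cartesianProduct; cartesianProductWith; allFin)
open import Data.List.Membership.Propositional using (_∈_)
import Data.List.Membership.DecPropositional as DecMembership
open import Data.List.Membership.Propositional.Properties using (∈-∃++; ∈-++⁺ʳ; ∈-filter⁺; ∈-filter⁻; ∈-map⁺; ∈-map⁻; ∈-allFin; ∈-cartesianProductWith⁺; ∈-cartesianProduct⁺)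
open import Data.List.Membership.Propositional.Properties.WithK using (unique∧set⇒bag)
open import Data.List.Properties using (length-filter; ∷ʳ-injective; ∷-injective; ++-assoc; ++-cancelˡ; concat-map-[_]; length-map; length-++; filter-++; filter-none; filter-all; filter-accept; filter-reject; map-id-local; map-∘; length-tabulate)
open import Data.List.Relation.Binary.BagAndSetEquality using (∼bag⇒↭)
open import Data.List.Relation.Binary.Permutation.Propositional using (_↭_; ↭-sym; ↭⇒↭ₛ)
open import Data.List.Relation.Binary.Permutation.Propositional.Properties using (↭-length)
import Data.List.Relation.Binary.Permutation.Setoid.Properties as Permutationₛ
open import Data.List.Relation.Unary.All as All using (All; []; _∷_)
open import Data.List.Relation.Unary.All.Properties using (all-filter; all⁺; all⁻; ¬Any⇒All¬)
open import Data.List.Relation.Unary.AllPairs using ([]; _∷_)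
open import Data.List.Relation.Unary.Any as Any using (here; there)
open import Data.List.Relation.Unary.Any.Properties using (any⁺; any⁻)
open import Data.List.Relation.Unary.Unique.Propositional using (Unique)
import Data.List.Relation.Unary.Unique.Propositional.Properties as Unique
open import Data.Nat using (ℕ; zero; suc; _+_; _*_; _∸_; _≤_; _<_; z≤n; s≤s) renaming (_≟_ to _≟ℕ_)
open import Data.Nat.Induction using (<-wellFounded)
open import Data.Nat.Properties using (*-suc; *-zeroʳ; m≤n⇒m≤1+n; m<n⇒m<1+n; ∸-monoʳ-<)
open import Data.Product as Product using (∃; ∃₂; _×_; _,_; proj₁; proj₂; uncurry)
open import Data.Sum using (_⊎_; inj₁; inj₂)
open import Data.Vec using (Vec; lookup; tabulate) renaming ([] to []ᵥ; _∷_ to _∷ᵥ_)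
open import Data.Vec.Properties using (lookup∘tabulate; tabulate∘lookup; tabulate-cong) renaming (∷-injective to ∷ᵥ-injective)
open import Effect.Monad using (RawMonad)
open import Function using (_∘_; _⇔_; id; case_of_)
open import Function.Bundles using (mk⇔; Equivalence)
open import Function.Definitions using (Injective)
open import Induction.WellFounded using (Acc; acc)
open import Relation.Binary.PropositionalEquality using (setoid; _≡_; _≢_; refl; sym; trans; cong; cong₂; subst; module ≡-Reasoning)
open import Relation.Nullary using (¬_; Dec; yes; no; does; contradiction)
open import Relation.Nullary.Decidable using (¬¬-excluded-middle; decidable-stable; dec-true; toWitness; fromWitness; toWitnessFalse; fromWitnessFalse)
open import Relation.Nullary.Negation using (¬¬-Monad)

private
  variable
    ℓ ℓ′ ℓ″ : Level
    A : Set ℓ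
    B : Set ℓ′
    C : Set ℓ″
    n k : ℕ

==⇒≡ : {x y : Fin k} → T (x == y) → x ≡ y
==⇒≡ = toWitness

≡⇒== : {x y : Fin k} → x ≡ y → T (x == y)
≡⇒== = fromWitness

not-==⇒≢ : {x y : Fin k} → T (not (x == y)) → x ≢ y
not-==⇒≢ = toWitnessFalse

≢⇒not-== : {x y : Fin k} → x ≢ y → T (not (x == y))
≢⇒not-== = fromWitnessFalse

private
  T-not-∨⁺ : ∀ {a b} → (a ≡ true → T b) → T (not a ∨ b)
  T-not-∨⁺ {true}  f = f refl
  T-not-∨⁺ {false} _ = _

  T-not-∨⁻ : ∀ {a b} → T (not a ∨ b) → a ≡ true → T b
  T-not-∨⁻ t refl = t

  ∧≡true : ∀ {a b} → a ≡ true → b ≡ true → a ∧ b ≡ true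
  ∧≡true refl refl = refl

  ∧≡true⁻ : ∀ {a b} → a ∧ b ≡ true → a ≡ true × b ≡ true
  ∧≡true⁻ {true} {true} _ = refl , refl

  all-allFin⁺ : (p : Fin n → Bool) → T (all p (allFin n)) → ∀ x → T (p x)
  all-allFin⁺ p t x = All.lookup (all⁺ p _ t) (∈-allFin x)

  all-allFin⁻ : (p : Fin n → Bool) → (∀ x → T (p x)) → T (all p (allFin n))
  all-allFin⁻ {n} p h = all⁻ p {allFin n} (All.tabulate λ {x} _ → h x)

  any-allFin⁻ : (p : Fin n → Bool) → T (any p (allFin n)) → ∃ λ x → T (p x)
  any-allFin⁻ {n} p t = Any.satisfied (any⁻ p (allFin n) t)

  any-allFin⁺ : (p : Fin n → Bool) → ∀ x → T (p x) → T (any p (allFin n))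
  any-allFin⁺ p x t = any⁺ p (Any.map (λ { refl → t }) (∈-allFin x))

IsListing : {A : Set ℓ} → List A → Set ℓ
IsListing xs = Unique xs × (∀ x → x ∈ xs)

↭-fromSameElements : {xs ys : List A} → Unique xs → Unique ys → (∀ {z} → z ∈ xs ⇔ z ∈ ys) → xs ↭ ys
↭-fromSameElements ux uy same = ∼bag⇒↭ (unique∧set⇒bag ux uy same)

allFin-isListing : ∀ k → IsListing (allFin k)
allFin-isListing k = Unique.allFin⁺ k , ∈-allFin

cartesianProduct-isListing : {xs : List A} {ys : List B} → IsListing xs → IsListing ys → IsListing (cartesianProduct xs ys)
cartesianProduct-isListing (ux , cx) (uy , cy) =
  Unique.cartesianProduct⁺ ux uy , λ (x , y) → ∈-cartesianProduct⁺ (cx x) (cy y)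

Unique-resp-↭ : {xs ys : List A} → xs ↭ ys → Unique xs → Unique ys
Unique-resp-↭ {A = A} xs↭ys = Permutationₛ.Unique-resp-↭ (setoid A) (↭⇒↭ₛ xs↭ys)

Unique-++⁻ʳ : ∀ (xs : List A) {ys} → Unique (xs ++ ys) → Unique ys
Unique-++⁻ʳ []       u       = u
Unique-++⁻ʳ (_ ∷ xs) (_ ∷ u) = Unique-++⁻ʳ xs u

Unique-prefix : ∀ (xs xs′ : List A) {a ys ys′} → Unique (xs ++ a ∷ ys) → xs ++ a ∷ ys ≡ xs′ ++ a ∷ ys′ → xs ≡ xs′
Unique-prefix []       []        _           _  = refl
Unique-prefix []       (_ ∷ xs′) (a≢ys ∷ _)  eq with refl , ys≡ ← ∷-injective eq =
  contradiction refl (All.lookup a≢ys (subst (_ ∈_) (sym ys≡) (∈-++⁺ʳ xs′ (here refl))))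
Unique-prefix (_ ∷ xs) []        (c≢xs ∷ _)  eq with refl , _ ← ∷-injective eq =
  contradiction refl (All.lookup c≢xs (∈-++⁺ʳ xs (here refl)))
Unique-prefix (_ ∷ xs) (_ ∷ xs′) (_ ∷ u)     eq with refl , eq′ ← ∷-injective eq =
  cong (_ ∷_) (Unique-prefix xs xs′ u eq′)

module _ (p : A → Bool) (q : B → Bool) (f : A → B) (g : B → A)
         (p⇒q : ∀ x → T (p x) → T (q (f x))) (q⇒p : ∀ y → T (q y) → T (p (g y)))
         (g∘f : ∀ x → T (p x) → g (f x) ≡ x) (f∘g : ∀ y → T (q y) → f (g y) ≡ y) where

  length-filterᵇ-bijection : {xs : List A} {ys : List B} → IsListing xs → IsListing ys →
                             length (filterᵇ p xs) ≡ length (filterᵇ q ys)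
  length-filterᵇ-bijection {xs} {ys} (ux , cx) (uy , cy) = begin
    length (filterᵇ p xs)          ≡⟨ length-map f ps ⟨
    length (map f (filterᵇ p xs))  ≡⟨ ↭-length image↭ ⟩
    length (filterᵇ q ys)          ∎
    where
    open ≡-Reasoning
    ps : List A
    ps = filterᵇ p xs
    g∘f-on-ps : map g (map f ps) ≡ ps
    g∘f-on-ps = trans (sym (map-∘ ps)) (map-id-local (All.map (g∘f _) (all-filter (T? ∘ p) xs)))
    unique-image : Unique (map f ps)
    unique-image = Unique.map⁻ (subst Unique (sym g∘f-on-ps) (Unique.filter⁺ (T? ∘ p) {xs} ux))
    to : ∀ {y} → y ∈ map f ps → y ∈ filterᵇ q ys
    to y∈ with ∈-map⁻ f y∈
    ... | x , x∈ , refl = ∈-filter⁺ (T? ∘ q) (cy (f x)) (p⇒q x (proj₂ (∈-filter⁻ (T? ∘ p) {xs = xs} x∈)))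
    from : ∀ {y} → y ∈ filterᵇ q ys → y ∈ map f ps
    from {y} y∈ = subst (_∈ map f ps) (f∘g y qy) (∈-map⁺ f (∈-filter⁺ (T? ∘ p) (cx (g y)) (q⇒p y qy)))
      where
      qy : T (q y)
      qy = proj₂ (∈-filter⁻ (T? ∘ q) {xs = ys} y∈)
    image↭ : map f ps ↭ filterᵇ q ys
    image↭ = ↭-fromSameElements unique-image (Unique.filter⁺ (T? ∘ q) {ys} uy) (mk⇔ to from)

filterᵇ-map : (q : B → Bool) (h : A → B) (xs : List A) → filterᵇ q (map h xs) ≡ map h (filterᵇ (q ∘ h) xs)
filterᵇ-map q h [] = refl
filterᵇ-map q h (x ∷ xs) with q (h x)
... | true  = cong (h x ∷_) (filterᵇ-map q h xs)
... | false = filterᵇ-map q h xs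

module _ (p : A → Bool) (r : A → B → Bool) (ys : List B) {K : ℕ}
         (count-r : ∀ x → length (filterᵇ (r x) ys) ≡ K) where

  private
    Q : A × B → Bool
    Q = uncurry (λ x y → p x ∧ r x y)

    count-row : ∀ x → length (filterᵇ Q (map (x ,_) ys)) ≡ (if p x then K else 0)
    count-row x = begin
      length (filterᵇ Q (map (x ,_) ys))                    ≡⟨ cong length (filterᵇ-map Q (x ,_) ys) ⟩
      length (map (x ,_) (filterᵇ (λ y → p x ∧ r x y) ys))  ≡⟨ length-map (x ,_) (filterᵇ (λ y → p x ∧ r x y) ys) ⟩
      length (filterᵇ (λ y → p x ∧ r x y) ys)               ≡⟨ by-cases (p x) ⟩
      (if p x then K else 0)                                ∎
      where
      open ≡-Reasoning
      by-cases : ∀ b → length (filterᵇ (λ y → b ∧ r x y) ys) ≡ (if b then K else 0)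
      by-cases true  = count-r x
      by-cases false = cong length (filter-none (T? ∘ λ _ → false) (All.universal (λ _ ()) ys))

    add-row : ∀ x xs → (if p x then K else 0) + K * length (filterᵇ p xs) ≡ K * length (filterᵇ p (x ∷ xs))
    add-row x xs with p x
    ... | true  = sym (*-suc K _)
    ... | false = refl

  length-filterᵇ-cartesianProduct :
    ∀ xs → length (filterᵇ (uncurry (λ x y → p x ∧ r x y)) (cartesianProduct xs ys)) ≡ K * length (filterᵇ p xs)
  length-filterᵇ-cartesianProduct []       = sym (*-zeroʳ K)
  length-filterᵇ-cartesianProduct (x ∷ xs) = begin
    length (filterᵇ Q (map (x ,_) ys ++ cartesianProduct xs ys))
      ≡⟨ cong length (filter-++ (T? ∘ Q) (map (x ,_) ys) _) ⟩
    length (filterᵇ Q (map (x ,_) ys) ++ filterᵇ Q (cartesianProduct xs ys))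
      ≡⟨ length-++ (filterᵇ Q (map (x ,_) ys)) ⟩
    length (filterᵇ Q (map (x ,_) ys)) + length (filterᵇ Q (cartesianProduct xs ys))
      ≡⟨ cong₂ _+_ (count-row x) (length-filterᵇ-cartesianProduct xs) ⟩
    (if p x then K else 0) + K * length (filterᵇ p xs)
      ≡⟨ add-row x xs ⟩
    K * length (filterᵇ p (x ∷ xs)) ∎
    where open ≡-Reasoning

module _ {a : Fin k} where

  private
    ≢a : Fin k → Bool
    ≢a b = not (b == a)

  length-filterᵇ-≢ : ∀ {xs} → Unique xs → a ∈ xs → suc (length (filterᵇ ≢a xs)) ≡ length xs
  length-filterᵇ-≢ {_ ∷ ys} (a≢ys ∷ _) (here refl) = cong suc (begin
    length (filterᵇ ≢a (a ∷ ys))  ≡⟨ cong length (filter-reject (T? ∘ ≢a) {x = a} {xs = ys} (λ a≢a → not-==⇒≢ a≢a refl)) ⟩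
    length (filterᵇ ≢a ys)        ≡⟨ cong length (filter-all (T? ∘ ≢a) {ys} (All.map (λ a≢b → ≢⇒not-== (a≢b ∘ sym)) a≢ys)) ⟩
    length ys                     ∎)
    where open ≡-Reasoning
  length-filterᵇ-≢ {y ∷ ys} (y≢ys ∷ u) (there a∈ys) = begin
    suc (length (filterᵇ ≢a (y ∷ ys)))  ≡⟨ cong (suc ∘ length) (filter-accept (T? ∘ ≢a) {xs = ys} (≢⇒not-== (All.lookup y≢ys a∈ys))) ⟩
    suc (suc (length (filterᵇ ≢a ys)))  ≡⟨ cong suc (length-filterᵇ-≢ u a∈ys) ⟩
    suc (length ys)                     ∎
    where open ≡-Reasoning

  length-filterᵇ-≢-allFin : length (filterᵇ ≢a (allFin k)) ≡ k ∸ 1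
  length-filterᵇ-≢-allFin = cong (_∸ 1) (trans (length-filterᵇ-≢ (Unique.allFin⁺ k) (∈-allFin a)) (length-tabulate {n = k} id))

module _ {p q : A → Bool} (p⇒q : ∀ x → T (p x) → T (q x)) where

  length-filterᵇ-mono : ∀ xs → length (filterᵇ p xs) ≤ length (filterᵇ q xs)
  length-filterᵇ-mono []       = z≤n
  length-filterᵇ-mono (x ∷ xs) with p x in px | q x in qx
  ... | true  | true  = s≤s (length-filterᵇ-mono xs)
  ... | true  | false = ⊥-elim (subst T qx (p⇒q x (Equivalence.from T-≡ px)))
  ... | false | true  = m≤n⇒m≤1+n (length-filterᵇ-mono xs)
  ... | false | false = length-filterᵇ-mono xs

  length-filterᵇ-< : ∀ {x xs} → x ∈ xs → T (q x) → ¬ T (p x) → length (filterᵇ p xs) < length (filterᵇ q xs)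
  length-filterᵇ-< {x} {_ ∷ xs} (here refl) qx ¬px with p x | q x
  ... | true  | _     = contradiction _ ¬px
  ... | false | true  = s≤s (length-filterᵇ-mono xs)
  ... | false | false = ⊥-elim qx
  length-filterᵇ-< {xs = y ∷ ys} (there x∈) qx ¬px with p y in py | q y in qy
  ... | true  | true  = s≤s (length-filterᵇ-< x∈ qx ¬px)
  ... | true  | false = ⊥-elim (subst T qy (p⇒q y (Equivalence.from T-≡ py)))
  ... | false | true  = m<n⇒m<1+n (length-filterᵇ-< x∈ qx ¬px)
  ... | false | false = length-filterᵇ-< x∈ qx ¬px

concatMap-map≡cartesianProductWith : (f : A → B → C) (xs : List A) (ys : List B) →
  concatMap (λ x → map (f x) ys) xs ≡ cartesianProductWith f xs ys
concatMap-map≡cartesianProductWith f []       ys = refl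
concatMap-map≡cartesianProductWith f (x ∷ xs) ys = cong (map (f x) ys ++_) (concatMap-map≡cartesianProductWith f xs ys)

allVecs-isListing : ∀ n k → IsListing (allVecs n k)
allVecs-isListing zero    k = All.[] ∷ [] , λ { []ᵥ → here refl }
allVecs-isListing (suc n) k =
  subst IsListing (sym (concatMap-map≡cartesianProductWith _∷ᵥ_ (allFin k) (allVecs n k)))
    ( Unique.cartesianProductWith⁺ _∷ᵥ_ ∷ᵥ-injective (Unique.allFin⁺ k) (proj₁ rest)
    , λ { (x ∷ᵥ c) → ∈-cartesianProductWith⁺ _∷ᵥ_ (∈-allFin x) (proj₂ rest c) })
  where
  rest : IsListing (allVecs n k)
  rest = allVecs-isListing n k

countVecs : ∀ n k → (Vec (Fin k) n → Bool) → ℕ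
countVecs n k p = length (filterᵇ p (allVecs n k))

countVecs-cong : {p q : Vec (Fin k) n → Bool} → (∀ c → T (p c) → T (q c)) → (∀ c → T (q c) → T (p c)) →
                 countVecs n k p ≡ countVecs n k q
countVecs-cong {k} {n} {p} {q} p⇒q q⇒p =
  length-filterᵇ-bijection p q id id p⇒q q⇒p (λ _ _ → refl) (λ _ _ → refl) (allVecs-isListing n k) (allVecs-isListing n k)

record Flowing (H : Digraph n) (c : Fin n → Fin k) : Set where
  field
    proper        : ∀ {x y} → Edge H x y → c x ≢ c y
    sources-agree : ∀ {x x′ y} → Edge H x y → Edge H x′ y → c x ≡ c x′
    targets-agree : ∀ {x y y′} → Edge H x y → Edge H x y′ → c y ≡ c y′

-- The conjuncts of isFlowing H c at the pair (x , y); they unfold to the body of isFlowing.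
private
  module Clauses (H : Digraph n) (c : Vec (Fin k) n) (x y : Fin n) where
    properAt : Bool
    properAt = not (H x y) ∨ not (lookup c x == lookup c y)
    sourcesAt : Fin n → Bool
    sourcesAt x′ = not (H x y ∧ H x′ y) ∨ (lookup c x == lookup c x′)
    targetsAt : Fin n → Bool
    targetsAt y′ = not (H x y ∧ H x y′) ∨ (lookup c y == lookup c y′)
    clause : Bool
    clause = properAt ∧ all sourcesAt (allFin n) ∧ all targetsAt (allFin n)

isFlowing⇒Flowing : (H : Digraph n) (c : Vec (Fin k) n) → T (isFlowing H c) → Flowing H (lookup c)
isFlowing⇒Flowing {n} H c ok = record
  { proper        = λ {x} {y} e → not-==⇒≢ (T-not-∨⁻ (proj₁ (split x y)) e)
  ; sources-agree = λ {x} {x′} {y} e e′ →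
      ==⇒≡ (T-not-∨⁻ (all-allFin⁺ (sourcesAt x y) (proj₁ (proj₂ (split x y))) x′) (∧≡true e e′))
  ; targets-agree = λ {x} {y} {y′} e e′ →
      ==⇒≡ (T-not-∨⁻ (all-allFin⁺ (targetsAt x y) (proj₂ (proj₂ (split x y))) y′) (∧≡true e e′))
  }
  where
  open Clauses H c
  split : ∀ x y → T (properAt x y) × T (all (sourcesAt x y) (allFin n)) × T (all (targetsAt x y) (allFin n))
  split x y = Product.map₂ (Equivalence.to T-∧) (Equivalence.to T-∧
    (all-allFin⁺ (clause x) (all-allFin⁺ (λ x → all (clause x) (allFin n)) ok x) y))

Flowing⇒isFlowing : (H : Digraph n) (c : Vec (Fin k) n) → Flowing H (lookup c) → T (isFlowing H c)
Flowing⇒isFlowing {n} H c fl =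
  all-allFin⁻ (λ x → all (clause x) (allFin n)) λ x → all-allFin⁻ (clause x) λ y →
    Equivalence.from T-∧ (T-not-∨⁺ (≢⇒not-== ∘ proper) , Equivalence.from T-∧
      ( all-allFin⁻ (sourcesAt x y) (λ _ → T-not-∨⁺ λ e → ≡⇒== (uncurry sources-agree (∧≡true⁻ e)))
      , all-allFin⁻ (targetsAt x y) (λ _ → T-not-∨⁺ λ e → ≡⇒== (uncurry targets-agree (∧≡true⁻ e)))))
  where
  open Flowing fl
  open Clauses H c

Flowing-resp : {H : Digraph n} {c c′ : Fin n → Fin k} → (∀ x → c x ≡ c′ x) → Flowing H c → Flowing H c′
Flowing-resp {c = c} {c′} c≗c′ fl = record
  { proper        = λ e eq → proper e (trans (c≗c′ _) (trans eq (sym (c≗c′ _))))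
  ; sources-agree = λ e e′ → trans (sym (c≗c′ _)) (trans (sources-agree e e′) (c≗c′ _))
  ; targets-agree = λ e e′ → trans (sym (c≗c′ _)) (trans (targets-agree e e′) (c≗c′ _))
  }
  where open Flowing fl

Flowing-anti-mono : {G H : Digraph n} {c : Fin n → Fin k} → (∀ {x y} → Edge H x y → Edge G x y) → Flowing G c → Flowing H c
Flowing-anti-mono H⊆G fl = record
  { proper        = proper ∘ H⊆G
  ; sources-agree = λ e e′ → sources-agree (H⊆G e) (H⊆G e′)
  ; targets-agree = λ e e′ → targets-agree (H⊆G e) (H⊆G e′)
  }
  where open Flowing fl

deleteEdge : Digraph n → Fin n → Fin n → Digraph n
deleteEdge G v w x y = G x y ∧ not (x == v ∧ y == w)

record ExclusiveEdge (G : Digraph n) (v w : Fin n) : Set where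
  field
    edge     : Edge G v w
    only-out : ∀ {y} → Edge G v y → y ≡ w
    only-in  : ∀ {x} → Edge G x w → x ≡ v

module _ (G : Digraph n) (v w : Fin n) where

  deleteEdge⊆ : ∀ {x y} → Edge (deleteEdge G v w) x y → Edge G x y
  deleteEdge⊆ {x} {y} e = proj₁ (∧≡true⁻ {G x y} e)

  deleteEdge-absent : ¬ Edge (deleteEdge G v w) v w
  deleteEdge-absent e with v ≟ v | w ≟ w
  ... | yes _ | yes _  = case proj₂ (∧≡true⁻ {G v w} e) of λ ()
  ... | no v≢v | _     = v≢v refl
  ... | yes _ | no w≢w = w≢w refl

  deleteEdge-or-removed : ∀ {x y} → Edge G x y → (x ≡ v × y ≡ w) ⊎ Edge (deleteEdge G v w) x y
  deleteEdge-or-removed {x} {y} e with x ≟ v | y ≟ w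
  ... | yes x≡v | yes y≡w = inj₁ (x≡v , y≡w)
  ... | yes _   | no _    = inj₂ (∧≡true e refl)
  ... | no _    | _       = inj₂ (∧≡true e refl)

module _ {G : Digraph n} {v w : Fin n} (ex : ExclusiveEdge G v w) {c : Fin n → Fin k} where
  open ExclusiveEdge ex

  Flowing-deleteEdge⁻ : Flowing (deleteEdge G v w) c → c v ≢ c w → Flowing G c
  Flowing-deleteEdge⁻ fl cv≢cw = record { proper = proper′ ; sources-agree = sources-agree′ ; targets-agree = targets-agree′ }
    where
    open Flowing fl
    proper′ : ∀ {x y} → Edge G x y → c x ≢ c y
    proper′ e with deleteEdge-or-removed G v w e
    ... | inj₁ (refl , refl) = cv≢cw
    ... | inj₂ e             = proper e
    sources-agree′ : ∀ {x x′ y} → Edge G x y → Edge G x′ y → c x ≡ c x′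
    sources-agree′ e e′ with deleteEdge-or-removed G v w e | deleteEdge-or-removed G v w e′
    ... | inj₁ (refl , refl) | _                  = cong c (sym (only-in e′))
    ... | inj₂ _             | inj₁ (refl , refl) = cong c (only-in e)
    ... | inj₂ d             | inj₂ d′            = sources-agree d d′
    targets-agree′ : ∀ {x y y′} → Edge G x y → Edge G x y′ → c y ≡ c y′
    targets-agree′ e e′ with deleteEdge-or-removed G v w e | deleteEdge-or-removed G v w e′
    ... | inj₁ (refl , refl) | _                  = cong c (sym (only-out e′))
    ... | inj₂ _             | inj₁ (refl , refl) = cong c (only-out e)
    ... | inj₂ d             | inj₂ d′            = targets-agree d d′

module _ {G : Digraph n} {v w : Fin n} (ex : ExclusiveEdge G v w) where
  open ExclusiveEdge ex

  deleteEdge-no-in : ∀ {x} → ¬ Edge (deleteEdge G v w) x w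
  deleteEdge-no-in e with refl ← only-in (deleteEdge⊆ G v w e) = deleteEdge-absent G v w e

  deleteEdge-no-out : ∀ {y} → ¬ Edge (deleteEdge G v w) v y
  deleteEdge-no-out e with refl ← only-out (deleteEdge⊆ G v w e) = deleteEdge-absent G v w e

τ-deleteEdge : {G : Digraph n} {v w : Fin n} → ExclusiveEdge G v w →
  τ G k ≡ countVecs n k (λ c → isFlowing (deleteEdge G v w) c ∧ not (lookup c v == lookup c w))
τ-deleteEdge {n} {k} {G = G} {v} {w} ex = countVecs-cong {k} {n} {isFlowing G} to from
  where
  open ExclusiveEdge ex
  to : ∀ c → T (isFlowing G c) → T (isFlowing (deleteEdge G v w) c ∧ not (lookup c v == lookup c w))
  to c t with fl ← isFlowing⇒Flowing G c t = Equivalence.from T-∧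
    (Flowing⇒isFlowing _ c (Flowing-anti-mono (deleteEdge⊆ G v w) fl) , ≢⇒not-== (Flowing.proper fl edge))
  from : ∀ c → T (isFlowing (deleteEdge G v w) c ∧ not (lookup c v == lookup c w)) → T (isFlowing G c)
  from c t with fl , cv≠cw ← Equivalence.to T-∧ t =
    Flowing⇒isFlowing G c (Flowing-deleteEdge⁻ ex (isFlowing⇒Flowing _ c fl) (not-==⇒≢ cv≠cw))

transpose-matchˡ : (i j : Fin k) → transpose i j i ≡ j
transpose-matchˡ i j rewrite dec-true (i ≟ i) refl = refl

transpose-injective : (i j : Fin k) → Injective _≡_ _≡_ (transpose i j)
transpose-injective i j eq = trans (sym (transpose-inverse j i)) (trans (cong (transpose j i) eq) (transpose-inverse j i))

lookup-ext : {xs ys : Vec A n} → (∀ i → lookup xs i ≡ lookup ys i) → xs ≡ ys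
lookup-ext {xs = xs} {ys} eq = trans (sym (tabulate∘lookup xs)) (trans (tabulate-cong eq) (tabulate∘lookup ys))

recolour : (Fin n → Bool) → (Fin k → Fin k) → (Fin n → Fin k) → Fin n → Fin k
recolour s σ c x = if s x then σ (c x) else c x

module _ (s : Fin n → Bool) {σ : Fin k → Fin k} {c : Fin n → Fin k} where

  recolour-≡ : Injective _≡_ _≡_ σ → ∀ {x y} → s x ≡ s y → recolour s σ c x ≡ recolour s σ c y ⇔ c x ≡ c y
  recolour-≡ σ-inj {x} {y} sx≡sy rewrite sx≡sy with s y
  ... | true  = mk⇔ σ-inj (cong σ)
  ... | false = mk⇔ id id

  recolour-inverse : {ρ : Fin k → Fin k} → (∀ a → ρ (σ a) ≡ a) → ∀ x → recolour s ρ (recolour s σ c) x ≡ c x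
  recolour-inverse ρσ x with s x
  ... | true  = ρσ (c x)
  ... | false = refl

  Flowing-recolour : {H : Digraph n} → (∀ {x y} → Edge H x y → s x ≡ s y) → Injective _≡_ _≡_ σ →
                     Flowing H c → Flowing H (recolour s σ c)
  Flowing-recolour s-resp σ-inj fl = record
    { proper        = λ e eq → proper e (Equivalence.to (recolour-≡ σ-inj (s-resp e)) eq)
    ; sources-agree = λ e e′ → Equivalence.from (recolour-≡ σ-inj (trans (s-resp e) (sym (s-resp e′)))) (sources-agree e e′)
    ; targets-agree = λ e e′ → Equivalence.from (recolour-≡ σ-inj (trans (sym (s-resp e)) (s-resp e′))) (targets-agree e e′)
    }
    where open Flowing fl

record Separates (H : Digraph n) (s : Fin n → Bool) (v w : Fin n) : Set where
  field
    respects-edges : ∀ {x y} → Edge H x y → s x ≡ s y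
    side-v         : s v ≡ false
    side-w         : s w ≡ true

module _ {H : Digraph n} {s : Fin n → Bool} {v w : Fin n} (sep : Separates H s v w) where
  open Separates sep

  swapSide : Fin k → Fin k → Vec (Fin k) n → Vec (Fin k) n
  swapSide i j c = tabulate (recolour s (transpose i j) (lookup c))

  module _ (i j : Fin k) (c : Vec (Fin k) n) where

    lookup-swapSide-v : lookup (swapSide i j c) v ≡ lookup c v
    lookup-swapSide-v rewrite lookup∘tabulate (recolour s (transpose i j) (lookup c)) v | side-v = refl

    lookup-swapSide-w : lookup (swapSide i j c) w ≡ transpose i j (lookup c w)
    lookup-swapSide-w rewrite lookup∘tabulate (recolour s (transpose i j) (lookup c)) w | side-w = refl

    swapSide-inverse : swapSide i j (swapSide j i c) ≡ c
    swapSide-inverse = lookup-ext λ x → begin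
      lookup (swapSide i j (swapSide j i c)) x
        ≡⟨ lookup∘tabulate _ x ⟩
      recolour s (transpose i j) (lookup (swapSide j i c)) x
        ≡⟨ cong (λ a → if s x then transpose i j a else a) (lookup∘tabulate _ x) ⟩
      recolour s (transpose i j) (recolour s (transpose j i) (lookup c)) x
        ≡⟨ recolour-inverse s {transpose j i} {lookup c} {transpose i j} (λ _ → transpose-inverse i j) x ⟩
      lookup c x ∎
      where open ≡-Reasoning

    isFlowing-swapSide : T (isFlowing H c) → T (isFlowing H (swapSide i j c))
    isFlowing-swapSide t = Flowing⇒isFlowing H (swapSide i j c)
      (Flowing-resp (λ x → sym (lookup∘tabulate (recolour s (transpose i j) (lookup c)) x))
        (Flowing-recolour s {transpose i j} {lookup c} respects-edges (transpose-injective i j) (isFlowing⇒Flowing H c t)))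

  module _ {k : ℕ} where

    private
      distinct joined : Vec (Fin k) n → Bool
      distinct c = isFlowing H c ∧ not (lookup c v == lookup c w)
      joined   c = isFlowing H c ∧ (lookup c v == lookup c w)

      pairs : Vec (Fin k) n × Fin k → Bool
      pairs = uncurry (λ c b → joined c ∧ not (b == lookup c v))

      -- f exchanges the colours of w and v on the side of w, remembering the old colour of w; g undoes this.
      f : Vec (Fin k) n → Vec (Fin k) n × Fin k
      f c = swapSide (lookup c w) (lookup c v) c , lookup c w

      g : Vec (Fin k) n × Fin k → Vec (Fin k) n
      g (c , b) = swapSide (lookup c v) b c

      f-pairs : ∀ c → T (distinct c) → T (pairs (f c))
      f-pairs c t with fl , cv≠cw ← Equivalence.to T-∧ t =
        Equivalence.from T-∧ (Equivalence.from T-∧ (isFlowing-swapSide _ _ c fl , ≡⇒== joined-at-v)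
                             , ≢⇒not-== (λ eq → not-==⇒≢ cv≠cw (sym (trans eq (lookup-swapSide-v _ _ c)))))
        where
        joined-at-v : lookup (proj₁ (f c)) v ≡ lookup (proj₁ (f c)) w
        joined-at-v = trans (lookup-swapSide-v _ _ c)
                        (sym (trans (lookup-swapSide-w _ _ c) (transpose-matchˡ (lookup c w) (lookup c v))))

      g-distinct : ∀ cb → T (pairs cb) → T (distinct (g cb))
      g-distinct (c , b) t with t₁ , b≠cv ← Equivalence.to T-∧ t with fl , cv=cw ← Equivalence.to T-∧ t₁ =
        Equivalence.from T-∧ (isFlowing-swapSide _ _ c fl , ≢⇒not-== λ eq → not-==⇒≢ b≠cv (sym (begin
          lookup c v                            ≡⟨ lookup-swapSide-v _ _ c ⟨
          lookup (g (c , b)) v                  ≡⟨ eq ⟩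
          lookup (g (c , b)) w                  ≡⟨ lookup-swapSide-w _ _ c ⟩
          transpose (lookup c v) b (lookup c w) ≡⟨ cong (transpose (lookup c v) b) (==⇒≡ cv=cw) ⟨
          transpose (lookup c v) b (lookup c v) ≡⟨ transpose-matchˡ (lookup c v) b ⟩
          b                                     ∎)))
        where open ≡-Reasoning

      g∘f : ∀ c → T (distinct c) → g (f c) ≡ c
      g∘f c _ = trans (cong (λ i → swapSide i (lookup c w) (proj₁ (f c))) (lookup-swapSide-v _ _ c)) (swapSide-inverse _ _ c)

      f∘g : ∀ cb → T (pairs cb) → f (g cb) ≡ cb
      f∘g (c , b) t =
        cong₂ _,_ (trans (cong₂ (λ i j → swapSide i j (g (c , b))) w-is-b (lookup-swapSide-v _ _ c)) (swapSide-inverse _ _ c)) w-is-b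
        where
        cv=cw : lookup c v ≡ lookup c w
        cv=cw = ==⇒≡ (proj₂ (Equivalence.to (T-∧ {isFlowing H c}) (proj₁ (Equivalence.to (T-∧ {joined c}) t))))
        w-is-b : lookup (g (c , b)) w ≡ b
        w-is-b = trans (lookup-swapSide-w _ _ c) (trans (cong (transpose (lookup c v) b) (sym cv=cw)) (transpose-matchˡ (lookup c v) b))

    countVecs-separated : countVecs n k (λ c → isFlowing H c ∧ not (lookup c v == lookup c w))
                          ≡ (k ∸ 1) * countVecs n k (λ c → isFlowing H c ∧ (lookup c v == lookup c w))
    countVecs-separated = trans
      (length-filterᵇ-bijection distinct pairs f g f-pairs g-distinct g∘f f∘g
         (allVecs-isListing n k) (cartesianProduct-isListing (allVecs-isListing n k) (allFin-isListing k)))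
      (length-filterᵇ-cartesianProduct joined (λ c b → not (b == lookup c v)) (allFin k)
         (λ c → length-filterᵇ-≢-allFin {a = lookup c v}) (allVecs n k))

module _ {m} {v w : Fin (suc m)} (v≢w : v ≢ w) where

  private
    μ : Fin (suc m) → Fin m
    μ = merge v w v≢w

  merge-punchIn : ∀ a → μ (punchIn w a) ≡ a
  merge-punchIn a with punchIn w a ≟ w
  ... | yes eq = ⊥-elim (punchInᵢ≢i w a eq)
  ... | no _   = trans (punchOut-cong w refl) (punchOut-punchIn w)

  factor-through-merge : {h : Fin (suc m) → A} → h v ≡ h w → ∀ x → h (punchIn w (μ x)) ≡ h x
  factor-through-merge {h = h} hv≡hw x with x ≟ w
  ... | yes refl = trans (cong h (punchIn-punchOut _)) hv≡hw
  ... | no _     = cong h (punchIn-punchOut _)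

  merge-w : μ w ≡ μ v
  merge-w with w ≟ w | v ≟ w
  ... | no w≢w | _      = ⊥-elim (w≢w refl)
  ... | yes _  | yes eq = ⊥-elim (v≢w eq)
  ... | yes _  | no _   = punchOut-cong w refl

  merge-fibre : ∀ {x y} → μ x ≡ μ y → x ≡ y ⊎ (x ≡ w × y ≡ v) ⊎ (x ≡ v × y ≡ w)
  merge-fibre {x} {y} eq with x ≟ w | y ≟ w
  ... | yes x≡w | yes y≡w = inj₁ (trans x≡w (sym y≡w))
  ... | yes x≡w | no _    = inj₂ (inj₁ (x≡w , punchOut-injective {i = w} _ _ (sym eq)))
  ... | no _    | yes y≡w = inj₂ (inj₂ (punchOut-injective {i = w} _ _ eq , y≡w))
  ... | no _    | no _    = inj₁ (punchOut-injective {i = w} _ _ eq)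

  module _ {G : Digraph (suc m)} where

    private
      liftsTo : Fin m → Fin m → Fin (suc m) → Fin (suc m) → Bool
      liftsTo a b x y = G x y ∧ not (x == v ∧ y == w) ∧ (μ x == a) ∧ (μ y == b)

    contract-edge⁺ : ∀ {x y} → Edge (deleteEdge G v w) x y → Edge (contract G v w v≢w) (μ x) (μ y)
    contract-edge⁺ {x} {y} e with g , d ← ∧≡true⁻ {G x y} e = Equivalence.to T-≡
      (any-allFin⁺ (λ x′ → any (liftsTo (μ x) (μ y) x′) (allFin (suc m))) x
        (any-allFin⁺ (liftsTo (μ x) (μ y) x) y
          (Equivalence.from T-∧ (Equivalence.from T-≡ g , Equivalence.from T-∧
            (Equivalence.from T-≡ d , Equivalence.from T-∧ (≡⇒== {x = μ x} refl , ≡⇒== {x = μ y} refl))))))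

    contract-edge⁻ : ∀ {a b} → Edge (contract G v w v≢w) a b →
                     ∃₂ λ x y → Edge (deleteEdge G v w) x y × μ x ≡ a × μ y ≡ b
    contract-edge⁻ {a} {b} e
      with x , t ← any-allFin⁻ (λ x′ → any (liftsTo a b x′) (allFin (suc m))) (Equivalence.from T-≡ e)
      with y , t′ ← any-allFin⁻ (liftsTo a b x) t
      with g , t″ ← Equivalence.to (T-∧ {G x y}) t′
      with d , t‴ ← Equivalence.to (T-∧ {not (x == v ∧ y == w)}) t″
      with μx , μy ← Equivalence.to (T-∧ {μ x == a}) t‴
      = x , y , Equivalence.to T-≡ (Equivalence.from T-∧ (g , d)) , ==⇒≡ μx , ==⇒≡ μy

    Flowing-contract⁺ : {D : Fin m → Fin k} → Flowing (contract G v w v≢w) D → Flowing (deleteEdge G v w) (D ∘ μ)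
    Flowing-contract⁺ fl = record
      { proper        = proper ∘ contract-edge⁺
      ; sources-agree = λ e e′ → sources-agree (contract-edge⁺ e) (contract-edge⁺ e′)
      ; targets-agree = λ e e′ → targets-agree (contract-edge⁺ e) (contract-edge⁺ e′)
      }
      where open Flowing fl

    Flowing-contract⁻ : ExclusiveEdge G v w → {D : Fin m → Fin k} →
                        Flowing (deleteEdge G v w) (D ∘ μ) → Flowing (contract G v w v≢w) D
    Flowing-contract⁻ ex {D} fl = record { proper = proper′ ; sources-agree = sources-agree′ ; targets-agree = targets-agree′ }
      where
      open Flowing fl
      proper′ : ∀ {a b} → Edge (contract G v w v≢w) a b → D a ≢ D b
      proper′ e with _ , _ , d , refl , refl ← contract-edge⁻ e = proper d
      sources-agree′ : ∀ {a a′ b} → Edge (contract G v w v≢w) a b → Edge (contract G v w v≢w) a′ b → D a ≡ D a′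
      sources-agree′ e e′ with contract-edge⁻ e | contract-edge⁻ e′
      ... | _ , y , d , refl , refl | _ , y′ , d′ , refl , μy′≡μy with merge-fibre {y′} {y} μy′≡μy
      ... | inj₁ refl                = sources-agree d d′
      ... | inj₂ (inj₁ (refl , _))   = ⊥-elim (deleteEdge-no-in ex d′)
      ... | inj₂ (inj₂ (_ , refl))   = ⊥-elim (deleteEdge-no-in ex d)
      targets-agree′ : ∀ {a b b′} → Edge (contract G v w v≢w) a b → Edge (contract G v w v≢w) a b′ → D b ≡ D b′
      targets-agree′ e e′ with contract-edge⁻ e | contract-edge⁻ e′
      ... | x , _ , d , refl , refl | x′ , _ , d′ , μx′≡μx , refl with merge-fibre {x′} {x} μx′≡μx
      ... | inj₁ refl                = targets-agree d d′
      ... | inj₂ (inj₁ (_ , refl))   = ⊥-elim (deleteEdge-no-out ex d)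
      ... | inj₂ (inj₂ (refl , _))   = ⊥-elim (deleteEdge-no-out ex d′)

    module _ {k : ℕ} where

      restrict : Vec (Fin k) (suc m) → Vec (Fin k) m
      restrict c = tabulate (lookup c ∘ punchIn w)

      extend : Vec (Fin k) m → Vec (Fin k) (suc m)
      extend d = tabulate (lookup d ∘ μ)

      lookup-restrict-merge : ∀ c → lookup c v ≡ lookup c w → ∀ x → lookup (restrict c) (μ x) ≡ lookup c x
      lookup-restrict-merge c cv≡cw x =
        trans (lookup∘tabulate (lookup c ∘ punchIn w) (μ x)) (factor-through-merge {h = lookup c} cv≡cw x)

      extend∘restrict : ∀ c → lookup c v ≡ lookup c w → extend (restrict c) ≡ c
      extend∘restrict c cv≡cw = lookup-ext λ x →
        trans (lookup∘tabulate (lookup (restrict c) ∘ μ) x) (lookup-restrict-merge c cv≡cw x)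

      restrict∘extend : ∀ d → restrict (extend d) ≡ d
      restrict∘extend d = lookup-ext λ a →
        trans (lookup∘tabulate (lookup (extend d) ∘ punchIn w) a)
          (trans (lookup∘tabulate (lookup d ∘ μ) (punchIn w a)) (cong (lookup d) (merge-punchIn a)))

      lookup-extend-v≡w : ∀ d → lookup (extend d) v ≡ lookup (extend d) w
      lookup-extend-v≡w d = trans (lookup∘tabulate (lookup d ∘ μ) v)
        (trans (cong (lookup d) (sym merge-w)) (sym (lookup∘tabulate (lookup d ∘ μ) w)))

      countVecs-contract : ExclusiveEdge G v w →
        countVecs (suc m) k (λ c → isFlowing (deleteEdge G v w) c ∧ (lookup c v == lookup c w)) ≡ τ (contract G v w v≢w) k
      countVecs-contract ex =
        length-filterᵇ-bijection joined (isFlowing (contract G v w v≢w)) restrict extend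
          restrict-flowing extend-joined (λ c t → extend∘restrict c (joined⇒≡ c t)) (λ d _ → restrict∘extend d)
          (allVecs-isListing (suc m) k) (allVecs-isListing m k)
        where
        joined : Vec (Fin k) (suc m) → Bool
        joined c = isFlowing (deleteEdge G v w) c ∧ (lookup c v == lookup c w)

        joined⇒≡ : ∀ c → T (joined c) → lookup c v ≡ lookup c w
        joined⇒≡ c t = ==⇒≡ (proj₂ (Equivalence.to (T-∧ {isFlowing (deleteEdge G v w) c}) t))

        restrict-flowing : ∀ c → T (joined c) → T (isFlowing (contract G v w v≢w) (restrict c))
        restrict-flowing c t = Flowing⇒isFlowing _ (restrict c) (Flowing-contract⁻ ex
          (Flowing-resp (λ x → sym (lookup-restrict-merge c (joined⇒≡ c t) x))
            (isFlowing⇒Flowing _ c (proj₁ (Equivalence.to (T-∧ {isFlowing (deleteEdge G v w) c}) t)))))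

        extend-joined : ∀ d → T (isFlowing (contract G v w v≢w) d) → T (joined (extend d))
        extend-joined d t = Equivalence.from T-∧
          ( Flowing⇒isFlowing _ (extend d) (Flowing-resp (λ x → sym (lookup∘tabulate (lookup d ∘ μ) x))
              (Flowing-contract⁺ (isFlowing⇒Flowing _ d t)))
          , ≡⇒== (lookup-extend-v≡w d))

τ-ExclusiveEdge : ∀ {m} {G : Digraph (suc m)} {v w : Fin (suc m)} (v≢w : v ≢ w) {s : Fin (suc m) → Bool} →
                  ExclusiveEdge G v w → Separates (deleteEdge G v w) s v w →
                  ∀ k → τ G k ≡ (k ∸ 1) * τ (contract G v w v≢w) k
τ-ExclusiveEdge {m} {G} {v} {w} v≢w ex sep k = begin
  τ G k
    ≡⟨ τ-deleteEdge {k = k} ex ⟩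
  countVecs (suc m) k (λ c → isFlowing (deleteEdge G v w) c ∧ not (lookup c v == lookup c w))
    ≡⟨ countVecs-separated sep {k} ⟩
  (k ∸ 1) * countVecs (suc m) k (λ c → isFlowing (deleteEdge G v w) c ∧ (lookup c v == lookup c w))
    ≡⟨ cong ((k ∸ 1) *_) (countVecs-contract v≢w {k = k} ex) ⟩
  (k ∸ 1) * τ (contract G v w v≢w) k ∎
  where open ≡-Reasoning

module _ {a b : Fin n} where

  Consec-++ˡ : ∀ {l} zs → Consec a b l → Consec a b (l ++ zs)
  Consec-++ˡ zs (xs , ys , refl) = xs , ys ++ zs , ++-assoc xs (a ∷ b ∷ ys) zs

  Consec-++ʳ : ∀ {l} zs → Consec a b l → Consec a b (zs ++ l)
  Consec-++ʳ zs (xs , ys , refl) = zs ++ xs , ys , sym (++-assoc zs xs (a ∷ b ∷ ys))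

  Consec-concat : ∀ {L l} → l ∈ L → Consec a b l → Consec a b (concat L)
  Consec-concat {_ ∷ L}  (here refl) ab = Consec-++ˡ (concat L) ab
  Consec-concat {l′ ∷ _} (there l∈L) ab = Consec-++ʳ l′ (Consec-concat l∈L ab)

  ¬Consec-[-] : ∀ {z} → ¬ Consec a b [ z ]
  ¬Consec-[-] ([] , _ , ())
  ¬Consec-[-] (_ ∷ [] , _ , ())
  ¬Consec-[-] (_ ∷ _ ∷ _ , _ , ())

  Consec-pair : ∀ {x y} → Consec a b (x ∷ y ∷ []) → a ≡ x × b ≡ y
  Consec-pair ([] , _ , refl)    = refl , refl
  Consec-pair (_ ∷ xs , ys , eq) = contradiction (xs , ys , proj₂ (∷-injective eq)) ¬Consec-[-]

module _ {l : List (Fin n)} (u : Unique l) where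

  Unique-Consec-pred : ∀ {a b c} → Consec a c l → Consec b c l → a ≡ b
  Unique-Consec-pred {a} {b} {c} (xs , ys , refl) (xs′ , ys′ , eq) = proj₂ (∷ʳ-injective xs xs′
    (Unique-prefix (xs ++ [ a ]) (xs′ ++ [ b ]) (subst Unique (sym (++-assoc xs [ a ] (c ∷ ys))) u)
      (trans (++-assoc xs [ a ] (c ∷ ys)) (trans eq (sym (++-assoc xs′ [ b ] (c ∷ ys′)))))))

  Unique-Consec-succ : ∀ {a b c} → Consec a b l → Consec a c l → b ≡ c
  Unique-Consec-succ (xs , ys , refl) (xs′ , ys′ , eq) with refl ← Unique-prefix xs xs′ u eq =
    proj₁ (∷-injective (proj₂ (∷-injective (++-cancelˡ xs _ _ eq))))

module _ {G : Digraph n} {S : EdgeSet n} (mp : IsMultipath G S) where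

  private
    L : List (List (Fin n))
    L = proj₁ (proj₂ mp)

    concat-unique : Unique (concat L)
    concat-unique = Unique-resp-↭ (↭-sym (proj₁ (proj₂ (proj₂ mp)))) (Unique.allFin⁺ n)

    edge-consec : ∀ {x y} → S x y ≡ true → Consec x y (concat L)
    edge-consec xy with _ , l∈L , c ← proj₁ (proj₂ (proj₂ (proj₂ mp)) _ _) xy = Consec-concat l∈L c

  multipath-pred-unique : ∀ {a b c} → S a c ≡ true → S b c ≡ true → a ≡ b
  multipath-pred-unique ac bc = Unique-Consec-pred concat-unique (edge-consec ac) (edge-consec bc)

  multipath-succ-unique : ∀ {a b c} → S a b ≡ true → S a c ≡ true → b ≡ c
  multipath-succ-unique ab ac = Unique-Consec-succ concat-unique (edge-consec ab) (edge-consec ac)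

singleEdge : Fin n → Fin n → EdgeSet n
singleEdge x y a b = (a == x) ∧ (b == y)

singleEdge-self : ∀ (x y : Fin n) → singleEdge x y x y ≡ true
singleEdge-self x y = Equivalence.to T-≡ (Equivalence.from T-∧ (≡⇒== {x = x} refl , ≡⇒== {x = y} refl))

module _ {x y : Fin n} where

  singleEdge⁻ : ∀ {a b} → singleEdge x y a b ≡ true → a ≡ x × b ≡ y
  singleEdge⁻ {a} t with ax , by ← Equivalence.to (T-∧ {a == x}) (Equivalence.from T-≡ t) = ==⇒≡ ax , ==⇒≡ by

  singleEdge-multipath : {G : Digraph n} → Edge G x y → x ≢ y → IsMultipath G (singleEdge x y)
  singleEdge-multipath {G} e x≢y = ⊆G , (x ∷ y ∷ []) ∷ map [_] others , concat↭ , edges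
    where
    other : Fin n → Bool
    other a = not (a == x) ∧ not (a == y)
    others : List (Fin n)
    others = filterᵇ other (allFin n)

    ⊆G : singleEdge x y ⊆ₑ G
    ⊆G a b t with refl , refl ← singleEdge⁻ {a} {b} t = e

    others-avoid : All (λ a → a ≢ x × a ≢ y) others
    others-avoid = All.map (λ {a} t → Product.map not-==⇒≢ not-==⇒≢ (Equivalence.to (T-∧ {not (a == x)}) t))
                           (all-filter (T? ∘ other) (allFin n))

    unique : Unique (x ∷ y ∷ others)
    unique = (x≢y ∷ All.map (λ a≢x∧y → proj₁ a≢x∧y ∘ sym) others-avoid)
           ∷ All.map (λ a≢x∧y → proj₂ a≢x∧y ∘ sym) others-avoid
           ∷ Unique.filter⁺ (T? ∘ other) (Unique.allFin⁺ n)

    complete : ∀ {a} → a ∈ allFin n → a ∈ x ∷ y ∷ others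
    complete {a} _ with a ≟ x | a ≟ y
    ... | yes a≡x | _       = here a≡x
    ... | no _    | yes a≡y = there (here a≡y)
    ... | no a≢x  | no a≢y  = there (there (∈-filter⁺ (T? ∘ other) (∈-allFin a)
                                (Equivalence.from T-∧ (≢⇒not-== a≢x , ≢⇒not-== a≢y))))

    concat↭ : concat ((x ∷ y ∷ []) ∷ map [_] others) ↭ allFin n
    concat↭ = subst (λ zs → x ∷ y ∷ zs ↭ allFin n) (sym (concat-map-[_] others))
      (↭-fromSameElements unique (Unique.allFin⁺ n) (mk⇔ (λ _ → ∈-allFin _) complete))

    edges : ∀ a b → (singleEdge x y a b ≡ true → ∃ λ l → l ∈ (x ∷ y ∷ []) ∷ map [_] others × Consec a b l)
                  × ((∃ λ l → l ∈ (x ∷ y ∷ []) ∷ map [_] others × Consec a b l) → singleEdge x y a b ≡ true)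
    edges a b = to , from
      where
      to : singleEdge x y a b ≡ true → ∃ λ l → l ∈ (x ∷ y ∷ []) ∷ map [_] others × Consec a b l
      to t with refl , refl ← singleEdge⁻ {a} {b} t = _ , here refl , [] , [] , refl
      from : (∃ λ l → l ∈ (x ∷ y ∷ []) ∷ map [_] others × Consec a b l) → singleEdge x y a b ≡ true
      from (_ , here refl , ab) with refl , refl ← Consec-pair ab = singleEdge-self x y
      from (_ , there l∈ , ab) with _ , _ , refl ← ∈-map⁻ [_] l∈ = contradiction ab ¬Consec-[-]

module _ {n} (I : EdgeSet n → Set ℓ) where

  IsMaximal : EdgeSet n → Set ℓ
  IsMaximal B = I B × (∀ U → I U → B ⊆ₑ U → U ⊆ₑ B)

  private
    pairs : List (Fin n × Fin n)
    pairs = cartesianProduct (allFin n) (allFin n)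

    size : EdgeSet n → ℕ
    size S = length (filterᵇ (uncurry S) pairs)

    deficit : EdgeSet n → ℕ
    deficit S = length pairs ∸ size S

    deficit-decreases : ∀ {S U x y} → S ⊆ₑ U → U x y ≡ true → S x y ≡ false → deficit U < deficit S
    deficit-decreases {S} {U} {x} {y} S⊆U Uxy Sxy = ∸-monoʳ-<
      (length-filterᵇ-< (λ (a , b) t → Equivalence.from T-≡ (S⊆U a b (Equivalence.to T-≡ t)))
        (∈-cartesianProduct⁺ (∈-allFin x) (∈-allFin y)) (Equivalence.from T-≡ Uxy) (subst T Sxy))
      (length-filter (T? ∘ uncurry U) pairs)

  -- Were there no maximal extension, S itself would be maximal: a strictly larger
  -- independent set has a smaller deficit, so it extends to a maximal set containing S.
  ¬¬-maximal-extension : ∀ S → I S → ¬ ¬ (∃ λ B → IsMaximal B × S ⊆ₑ B)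
  ¬¬-maximal-extension S = go S (<-wellFounded (deficit S))
    where
    go : ∀ S → Acc _<_ (deficit S) → I S → ¬ ¬ (∃ λ B → IsMaximal B × S ⊆ₑ B)
    go S (acc rec) IS no-extension = no-extension (S , (IS , maximal) , λ _ _ → id)
      where
      maximal : ∀ U → I U → S ⊆ₑ U → U ⊆ₑ S
      maximal U IU S⊆U x y Uxy with S x y in Sxy
      ... | true  = refl
      ... | false = ⊥-elim (go U (rec (deficit-decreases S⊆U Uxy Sxy)) IU
                      λ (B , maxB , U⊆B) → no-extension (B , maxB , λ a b → U⊆B a b ∘ S⊆U a b))

coloop⇒ExclusiveEdge : {G : Digraph n} {v w : Fin n} → (∀ x → G x x ≡ false) → IsColoop G v w → ExclusiveEdge G v w
coloop⇒ExclusiveEdge {G = G} {v} {w} loop-free (vw , in-every-basis) =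
  record { edge = vw ; only-out = only-out ; only-in = only-in }
  where
  no-loop : ∀ {x y} → Edge G x y → x ≢ y
  no-loop {x} e refl = case trans (sym e) (loop-free x) of λ ()

  only-in : ∀ {x} → Edge G x w → x ≡ v
  only-in {x} xw = decidable-stable (x ≟ v) λ x≢v →
    ¬¬-maximal-extension (IsMultipath G) (singleEdge x w) (singleEdge-multipath xw (no-loop xw))
      λ (B , basis , xw∈B) → x≢v (multipath-pred-unique (proj₁ basis) (xw∈B x w (singleEdge-self x w)) (in-every-basis B basis))

  only-out : ∀ {y} → Edge G v y → y ≡ w
  only-out {y} vy = decidable-stable (y ≟ w) λ y≢w →
    ¬¬-maximal-extension (IsMultipath G) (singleEdge v y) (singleEdge-multipath vy (no-loop vy))
      λ (B , basis , vy∈B) → y≢w (multipath-succ-unique (proj₁ basis) (vy∈B v y (singleEdge-self v y)) (in-every-basis B basis))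

module _ {n} (R : Fin n → Fin n → Set) where

  data Walk : Fin n → Fin n → List (Fin n) → Set where
    halt : ∀ {x} → Walk x x [ x ]
    move : ∀ {x y z l} → R x y → Walk y z l → Walk x z (x ∷ l)

  walk-head : ∀ {x z a l} → Walk x z (a ∷ l) → a ≡ x
  walk-head halt       = refl
  walk-head (move _ _) = refl

  walk-suffix : ∀ xs {x z a ys} → Walk x z (xs ++ a ∷ ys) → Walk a z (a ∷ ys)
  walk-suffix []           W          with refl ← walk-head W = W
  walk-suffix (_ ∷ [])     (move _ W) = walk-suffix [] W
  walk-suffix (_ ∷ _ ∷ xs) (move _ W) = walk-suffix (_ ∷ xs) W

  walk-last : ∀ {x z l} → Walk x z l → ∃ λ xs → l ≡ xs ++ [ z ]
  walk-last halt                   = [] , refl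
  walk-last (move {x = x} _ W) with xs , refl ← walk-last W = x ∷ xs , refl

  walk-consec : ∀ {x z l a b} → Walk x z l → Consec a b l → R a b
  walk-consec halt       ([] , _ , ())
  walk-consec halt       (_ ∷ [] , _ , ())
  walk-consec halt       (_ ∷ _ ∷ _ , _ , ())
  walk-consec (move r W) ([] , _ , refl) with refl ← walk-head W = r
  walk-consec (move r W) (_ ∷ xs , ys , refl) = walk-consec W (xs , ys , refl)

  erase-loops : ∀ {x z l} → Walk x z l → ∃ λ l′ → Walk x z l′ × Unique l′
  erase-loops halt = _ , halt , All.[] ∷ []
  erase-loops {x} (move r W) with l′ , W′ , u′ ← erase-loops W with DecMembership._∈?_ _≟_ x l′
  ... | yes x∈l′ with xs , ys , refl ← ∈-∃++ x∈l′ = x ∷ ys , walk-suffix xs W′ , Unique-++⁻ʳ xs u′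
  ... | no x∉l′  = x ∷ l′ , move r W′ , ¬Any⇒All¬ l′ x∉l′ ∷ u′

  walk-nonempty : ∀ {x z l} → Walk x z l → 1 ≤ length l
  walk-nonempty halt       = s≤s z≤n
  walk-nonempty (move _ _) = s≤s z≤n

Connected⇒Walk : {H : Digraph n} {x z : Fin n} → Connected H x z → ∃ λ l → Walk (UAdj H) x z l
Connected⇒Walk here         = _ , halt
Connected⇒Walk (step xy yz) = _ , move xy (proj₂ (Connected⇒Walk yz))

-- A simple walk from v to w avoiding (v , w) would close up with it to a cycle.
deleteEdge-disconnects : {G : Digraph n} {v w : Fin n} → IsTree G → Edge G v w → ¬ Connected (deleteEdge G v w) v w
deleteEdge-disconnects {n} {G} {v} {w} (loop-free , antiparallel , _ , acyclic) e v~w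
  with _ , W , u ← erase-loops _ (proj₂ (Connected⇒Walk v~w)) = simple-walk W u
  where
  G′ : Digraph n
  G′ = deleteEdge G v w

  UAdj⊆ : ∀ {x y} → UAdj G′ x y → UAdj G x y
  UAdj⊆ (inj₁ d) = inj₁ (deleteEdge⊆ G v w d)
  UAdj⊆ (inj₂ d) = inj₂ (deleteEdge⊆ G v w d)

  closes-cycle : ∀ {l} → Walk (UAdj G′) v w (v ∷ l) → ∀ a b → CycConsec a b v l → UAdj G a b
  closes-cycle W a b (inj₁ a→b) = UAdj⊆ (walk-consec _ W a→b)
  closes-cycle W a b (inj₂ (xs , l≡xs∷a , refl))
    with ys , l≡ys∷w ← walk-last _ W with _ , refl ← ∷ʳ-injective xs ys (trans (sym l≡xs∷a) l≡ys∷w) = inj₂ e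

  simple-walk : ∀ {l} → Walk (UAdj G′) v w l → Unique l → ⊥
  simple-walk halt _ = case trans (sym e) (loop-free v) of λ ()
  simple-walk (move (inj₁ d) halt) _ = deleteEdge-absent G v w d
  simple-walk (move (inj₂ d) halt) _ = antiparallel v w e (deleteEdge⊆ G v w d)
  simple-walk W@(move _ (move _ W′)) u = acyclic v _ u (s≤s (walk-nonempty _ W′)) (closes-cycle W)

¬¬-decide-Fin : (P : Fin n → Set ℓ) → ¬ ¬ (∀ x → Dec (P x))
¬¬-decide-Fin {zero}  P = pure λ ()
  where open RawMonad ¬¬-Monad
¬¬-decide-Fin {suc n} P = do
  P₀? ← ¬¬-excluded-middle
  P₊? ← ¬¬-decide-Fin (P ∘ Fin.suc)
  pure λ { Fin.zero → P₀? ; (Fin.suc x) → P₊? x }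
  where open RawMonad ¬¬-Monad

Connected-separates : {H : Digraph n} {v w : Fin n} (reaches? : ∀ x → Dec (Connected H x w)) →
                      ¬ Connected H v w → Separates H (does ∘ reaches?) v w
Connected-separates {H = H} {v} {w} reaches? v↮w = record
  { respects-edges = respects-edges ; side-v = side-v ; side-w = side-w }
  where
  respects-edges : ∀ {x y} → Edge H x y → does (reaches? x) ≡ does (reaches? y)
  respects-edges {x} {y} e with reaches? x | reaches? y
  ... | yes _  | yes _  = refl
  ... | no _   | no _   = refl
  ... | yes x~w | no y↮w = ⊥-elim (y↮w (step (inj₂ e) x~w))
  ... | no x↮w | yes y~w = ⊥-elim (x↮w (step (inj₁ e) y~w))
  side-v : does (reaches? v) ≡ false
  side-v with reaches? v
  ... | yes v~w = ⊥-elim (v↮w v~w)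
  ... | no _    = refl
  side-w : does (reaches? w) ≡ true
  side-w with reaches? w
  ... | yes _   = refl
  ... | no w↮w  = ⊥-elim (w↮w here)

lemma5p9 : (m : ℕ) (G : Digraph (suc m)) → IsMPTree G →
    (v w : Fin (suc m)) (v≢w : v ≢ w) → IsColoop G v w →
    (k : ℕ) → 1 ≤ k → τ G k ≡ (k ∸ 1) * τ (contract G v w v≢w) k
lemma5p9 m G (_ , tree) v w v≢w coloop k _ =
  decidable-stable (τ G k ≟ℕ (k ∸ 1) * τ (contract G v w v≢w) k) do
    reaches? ← ¬¬-decide-Fin (λ x → Connected (deleteEdge G v w) x w)
    pure (τ-ExclusiveEdge v≢w (coloop⇒ExclusiveEdge (proj₁ tree) coloop)
            (Connected-separates reaches? (deleteEdge-disconnects tree (proj₁ coloop))) k)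
  where open RawMonad ¬¬-Monad
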